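{- In any Toeplitz graph, the degrees of two consecutive vertices $j, j+1$ differ by at most $1$. Moreover, for $G = G_n\langle t_1, \ldots, t_k\rangle$ with $B(G) = \{t_1, \ldots, t_k\}$ and each $j \in \{1, \ldots, n-1\}$: (a) $\deg(j) = \deg(j+1)$ if and only if $\{j, n-j\} \subseteq B(G)$ or $\{j, n-j\} \subseteq \{1,\ldots,n-1\} \setminus B(G)$; (b) $\deg(j) + 1 = \deg(j+1)$ if and only if $j \in B(G)$ and $n-j \notin B(G)$; (c) $\deg(j) - 1 = \deg(j+1)$ if and only if $n-j \in B(G)$ and $j \notin B(G)$.
   Context: For integers $1 \le t_1 < \cdots < t_k < n$, the Toeplitz graph $G_n\langle t_1, \ldots, t_k\rangle$ is the simple graph with vertex set $\{1, \ldots, n\}$ in which distinct vertices $i,j$ are adjacent iff $|i-j| \in \{t_1, \ldots, t_k\}$; every Toeplitz graph is of this form (adjacency matrix a symmetric $(0,1)$ Toeplitz matrix with zero diagonal). $\deg(i)$ is the degree of vertex $i$. -}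

module Defs where

open import Data.Nat using (ℕ; suc; _≤_; _<_; _≟_; ∣_-_∣)
open import Data.List using (List; []; _∷_; filter; length)
open import Data.List.Relation.Unary.All using (All)
open import Data.List.Relation.Unary.Linked using (Linked)
open import Data.List.Membership.DecPropositional _≟_ using (_∈_; _∈?_)
open import Data.Product using (_×_)
open import Relation.Binary.PropositionalEquality using (_≡_; _≢_)
open import Relation.Nullary using (¬_; Dec)
open import Relation.Nullary.Decidable using (_×-dec_; ¬?)

range : ℕ → ℕ → List ℕ
range a Data.Nat.zero = []
range a (suc m) = a ∷ range (suc a) m

vertices : ℕ → List ℕ
vertices n = range 1 n

record ToeplitzParams (n : ℕ) (ts : List ℕ) : Set where
  field
    nonempty   : ts ≢ []
    increasing : Linked _<_ ts
    positive   : All (λ t → 1 ≤ t) ts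
    bounded    : All (λ t → t < n) ts

Adj : List ℕ → ℕ → ℕ → Set
Adj ts i j = (¬ (i ≡ j)) × (∣ i - j ∣ ∈ ts)

Adj? : (ts : List ℕ) → (i j : ℕ) → Dec (Adj ts i j)
Adj? ts i j = ¬? (i ≟ j) ×-dec (∣ i - j ∣ ∈? ts)

deg : ℕ → List ℕ → ℕ → ℕ
deg n ts i = length (filter (Adj? ts i) (vertices n))

{-# OPTIONS --safe #-}
-- Write n = m + 1 and let c be the number of neighbours of j among 1, …, m.
-- Since adjacency only depends on the difference of the vertices, i ↦ i + 1
-- matches the neighbours of j in {1, …, m} with those of j + 1 in {2, …, n}.
-- Hence deg(j) = c + [n - j ∈ B] (the vertex n) and deg(j + 1) = c + [j ∈ B]
-- (the vertex 1), and all claims are statements about two indicators.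
module Submission where

open import Defs
open import Data.Nat using (ℕ; zero; suc; _≤_; _∸_; _≟_; _+_; z≤n; s≤s; ∣_-_∣)
open import Data.Nat.Properties
  using (+-comm; +-suc; +-identityʳ; +-cancelˡ-≡; +-monoʳ-≤; m≤m+n; suc-injective; <-irrefl;
         m≤n⇒m≤1+n; m<n⇒0<n∸m; m∸n≤m; m≤n⇒∣m-n∣≡n∸m; ∣-∣-identityʳ; module ≤-Reasoning)
open import Data.List using (List; []; _∷_; _++_; _∷ʳ_; filter; length)
open import Data.List.Properties using (filter-++; length-++)
open import Data.List.Membership.DecPropositional _≟_ using (_∈_; _∉_; _∈?_)
open import Data.Product using (_×_; _,_; proj₁; proj₂)
open import Data.Empty using (⊥-elim)
open import Data.Sum using (_⊎_; inj₁; inj₂; map₂)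
open import Function.Bundles using (_⇔_; mk⇔; module Equivalence)
import Function.Properties.Equivalence as ⇔
open import Relation.Binary.PropositionalEquality
  using (_≡_; refl; sym; trans; cong; cong₂; module ≡-Reasoning)
open import Relation.Nullary using (¬_; Dec; yes; no)
open import Relation.Unary using (Decidable)

indicator : {P : Set} → Dec P → ℕ
indicator (yes _) = 1
indicator (no _)  = 0

indicator≤1 : {P : Set} (P? : Dec P) → indicator P? ≤ 1
indicator≤1 (yes _) = s≤s z≤n
indicator≤1 (no _)  = z≤n

indicator-cong : {P Q : Set} (P? : Dec P) (Q? : Dec Q) → P ⇔ Q → indicator P? ≡ indicator Q?
indicator-cong (yes _) (yes _) _   = refl
indicator-cong (no _)  (no _)  _   = refl
indicator-cong (yes p) (no ¬q) P⇔Q = ⊥-elim (¬q (Equivalence.to P⇔Q p))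
indicator-cong (no ¬p) (yes q) P⇔Q = ⊥-elim (¬p (Equivalence.from P⇔Q q))

indicator≡indicator⇔ : {P Q : Set} (P? : Dec P) (Q? : Dec Q) →
  indicator P? ≡ indicator Q? ⇔ ((P × Q) ⊎ (¬ P × ¬ Q))
indicator≡indicator⇔ (yes p) (yes q) = mk⇔ (λ _ → inj₁ (p , q)) (λ _ → refl)
indicator≡indicator⇔ (no ¬p) (no ¬q) = mk⇔ (λ _ → inj₂ (¬p , ¬q)) (λ _ → refl)
indicator≡indicator⇔ (yes p) (no ¬q) =
  mk⇔ (λ ()) λ { (inj₁ (_ , q)) → ⊥-elim (¬q q) ; (inj₂ (¬p , _)) → ⊥-elim (¬p p) }
indicator≡indicator⇔ (no ¬p) (yes q) =
  mk⇔ (λ ()) λ { (inj₁ (p , _)) → ⊥-elim (¬p p) ; (inj₂ (_ , ¬q)) → ⊥-elim (¬q q) }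

suc-indicator≡indicator⇔ : {P Q : Set} (P? : Dec P) (Q? : Dec Q) →
  suc (indicator P?) ≡ indicator Q? ⇔ (Q × ¬ P)
suc-indicator≡indicator⇔ (no ¬p) (yes q) = mk⇔ (λ _ → q , ¬p) (λ _ → refl)
suc-indicator≡indicator⇔ (yes p) (yes _) = mk⇔ (λ ()) (λ (_ , ¬p) → ⊥-elim (¬p p))
suc-indicator≡indicator⇔ (yes p) (no _)  = mk⇔ (λ ()) (λ (_ , ¬p) → ⊥-elim (¬p p))
suc-indicator≡indicator⇔ (no _)  (no ¬q) = mk⇔ (λ ()) (λ (q , _) → ⊥-elim (¬q q))

module _ (c : ℕ) {P Q : Set} (P? : Dec P) (Q? : Dec Q) where

  +-indicator-≤ : c + indicator P? ≤ suc (c + indicator Q?)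
  +-indicator-≤ = begin
    c + indicator P? ≤⟨ +-monoʳ-≤ c (indicator≤1 P?) ⟩
    c + 1            ≡⟨ +-comm c 1 ⟩
    suc c            ≤⟨ s≤s (m≤m+n c _) ⟩
    suc (c + indicator Q?) ∎
    where open ≤-Reasoning

  +-indicator≡⇔ : c + indicator P? ≡ c + indicator Q? ⇔ ((P × Q) ⊎ (¬ P × ¬ Q))
  +-indicator≡⇔ = ⇔.trans (mk⇔ (+-cancelˡ-≡ c _ _) (cong (c +_))) (indicator≡indicator⇔ P? Q?)

  suc-+-indicator≡⇔ : suc (c + indicator P?) ≡ c + indicator Q? ⇔ (Q × ¬ P)
  suc-+-indicator≡⇔ =
    ⇔.trans (mk⇔ (λ e → +-cancelˡ-≡ c _ _ (trans (+-suc c _) e))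
                 (λ e → trans (sym (+-suc c _)) (cong (c +_) e)))
            (suc-indicator≡indicator⇔ P? Q?)

indicator-comparison : (c : ℕ) {P Q : Set} (P? : Dec P) (Q? : Dec Q) {a b : ℕ} →
  a ≡ c + indicator P? → b ≡ c + indicator Q? →
  ((a ≤ suc b) × (b ≤ suc a))
  × (a ≡ b ⇔ ((Q × P) ⊎ (¬ Q × ¬ P)))
  × (suc a ≡ b ⇔ (Q × ¬ P))
  × (a ≡ suc b ⇔ (P × ¬ Q))
indicator-comparison c P? Q? refl refl =
  (+-indicator-≤ c P? Q? , +-indicator-≤ c Q? P?) ,
  ⇔.trans (mk⇔ sym sym) (+-indicator≡⇔ c Q? P?) ,
  suc-+-indicator≡⇔ c P? Q? ,
  ⇔.trans (mk⇔ sym sym) (suc-+-indicator≡⇔ c Q? P?)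

count : {P : ℕ → Set} → Decidable P → List ℕ → ℕ
count P? xs = length (filter P? xs)

count-∷ : {P : ℕ → Set} (P? : Decidable P) (x : ℕ) (xs : List ℕ) →
  count P? (x ∷ xs) ≡ indicator (P? x) + count P? xs
count-∷ P? x xs with P? x
... | yes _ = refl
... | no _  = refl

count-∷ʳ : {P : ℕ → Set} (P? : Decidable P) (xs : List ℕ) (x : ℕ) →
  count P? (xs ∷ʳ x) ≡ count P? xs + indicator (P? x)
count-∷ʳ P? xs x = begin
  length (filter P? (xs ++ x ∷ []))              ≡⟨ cong length (filter-++ P? xs (x ∷ [])) ⟩
  length (filter P? xs ++ filter P? (x ∷ []))    ≡⟨ length-++ (filter P? xs) ⟩
  count P? xs + count P? (x ∷ [])                ≡⟨ cong (count P? xs +_) (count-∷ P? x []) ⟩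
  count P? xs + (indicator (P? x) + 0)           ≡⟨ cong (count P? xs +_) (+-identityʳ _) ⟩
  count P? xs + indicator (P? x)                 ∎
  where open ≡-Reasoning

range-suc : ∀ a m → range a (suc m) ≡ range a m ∷ʳ (a + m)
range-suc a zero    = cong (_∷ []) (sym (+-identityʳ a))
range-suc a (suc m) =
  cong (a ∷_) (trans (range-suc (suc a) m) (cong (range (suc a) m ∷ʳ_) (sym (+-suc a m))))

count-range-suc : {P Q : ℕ → Set} (P? : Decidable P) (Q? : Decidable Q) →
  (∀ x → P (suc x) ⇔ Q x) → ∀ a m → count P? (range (suc a) m) ≡ count Q? (range a m)
count-range-suc P? Q? P∘suc⇔Q a zero    = refl
count-range-suc P? Q? P∘suc⇔Q a (suc m) = begin
  count P? (range (suc a) (suc m))                 ≡⟨ count-∷ P? (suc a) _ ⟩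
  indicator (P? (suc a)) + count P? (range (suc (suc a)) m)
    ≡⟨ cong₂ _+_ (indicator-cong (P? (suc a)) (Q? a) (P∘suc⇔Q a))
                 (count-range-suc P? Q? P∘suc⇔Q (suc a) m) ⟩
  indicator (Q? a) + count Q? (range (suc a) m)    ≡⟨ count-∷ Q? a _ ⟨
  count Q? (range a (suc m))                       ∎
  where open ≡-Reasoning

Adj-suc⇔ : ∀ ts i a → Adj ts (suc i) (suc a) ⇔ Adj ts i a
Adj-suc⇔ ts i a = mk⇔ (λ (i≢a , d∈ts) → (λ i≡a → i≢a (cong suc i≡a)) , d∈ts)
                      (λ (i≢a , d∈ts) → (λ i≡a → i≢a (suc-injective i≡a)) , d∈ts)

Adj⇔distance∈ : ∀ ts {i a d} → ¬ i ≡ a → ∣ i - a ∣ ≡ d → Adj ts i a ⇔ d ∈ ts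
Adj⇔distance∈ ts i≢a refl = mk⇔ proj₂ (i≢a ,_)

module _ (ts : List ℕ) (m j : ℕ) (1≤j : 1 ≤ j) (j≤m : j ≤ m) where

  inner : ℕ
  inner = count (Adj? ts j) (range 1 m)

  deg≡inner+far : deg (suc m) ts j ≡ inner + indicator ((suc m ∸ j) ∈? ts)
  deg≡inner+far = begin
    count (Adj? ts j) (range 1 (suc m))            ≡⟨ cong (count (Adj? ts j)) (range-suc 1 m) ⟩
    count (Adj? ts j) (range 1 m ∷ʳ suc m)         ≡⟨ count-∷ʳ (Adj? ts j) (range 1 m) (suc m) ⟩
    inner + indicator (Adj? ts j (suc m))
      ≡⟨ cong (inner +_) (indicator-cong (Adj? ts j (suc m)) (_ ∈? ts)
                            (Adj⇔distance∈ ts (λ j≡n → <-irrefl j≡n (s≤s j≤m))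
                                               (m≤n⇒∣m-n∣≡n∸m (m≤n⇒m≤1+n j≤m)))) ⟩
    inner + indicator ((suc m ∸ j) ∈? ts)          ∎
    where open ≡-Reasoning

  deg-suc≡inner+near : deg (suc m) ts (suc j) ≡ inner + indicator (j ∈? ts)
  deg-suc≡inner+near = begin
    count (Adj? ts (suc j)) (1 ∷ range 2 m)        ≡⟨ count-∷ (Adj? ts (suc j)) 1 _ ⟩
    indicator (Adj? ts (suc j) 1) + count (Adj? ts (suc j)) (range 2 m)
      ≡⟨ cong₂ _+_ (indicator-cong (Adj? ts (suc j) 1) (j ∈? ts)
                      (Adj⇔distance∈ ts (λ j+1≡1 → <-irrefl (sym (suc-injective j+1≡1)) 1≤j)
                                         (∣-∣-identityʳ j)))
                   (count-range-suc (Adj? ts (suc j)) (Adj? ts j) (Adj-suc⇔ ts j) 1 m) ⟩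
    indicator (j ∈? ts) + inner                    ≡⟨ +-comm _ inner ⟩
    inner + indicator (j ∈? ts)                    ∎
    where open ≡-Reasoning

  degree-relations :
    ((deg (suc m) ts j ≤ suc (deg (suc m) ts (suc j))) × (deg (suc m) ts (suc j) ≤ suc (deg (suc m) ts j)))
    × (deg (suc m) ts j ≡ deg (suc m) ts (suc j) ⇔ ((j ∈ ts × (suc m ∸ j) ∈ ts) ⊎ (j ∉ ts × (suc m ∸ j) ∉ ts)))
    × (suc (deg (suc m) ts j) ≡ deg (suc m) ts (suc j) ⇔ (j ∈ ts × (suc m ∸ j) ∉ ts))
    × (deg (suc m) ts j ≡ suc (deg (suc m) ts (suc j)) ⇔ ((suc m ∸ j) ∈ ts × j ∉ ts))
  degree-relations = indicator-comparison inner (_ ∈? ts) (j ∈? ts) deg≡inner+far deg-suc≡inner+near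

lemma22 : (n : ℕ) (ts : List ℕ) → ToeplitzParams n ts →
    ((j : ℕ) → 1 ≤ j → suc j ≤ n →
      (deg n ts j ≤ suc (deg n ts (suc j))) × (deg n ts (suc j) ≤ suc (deg n ts j)))
    × ((j : ℕ) → 1 ≤ j → j ≤ n ∸ 1 →
      (deg n ts j ≡ deg n ts (suc j)
        ⇔ ((j ∈ ts × (n ∸ j) ∈ ts)
           ⊎ ((1 ≤ j × j ≤ n ∸ 1 × j ∉ ts) × (1 ≤ n ∸ j × n ∸ j ≤ n ∸ 1 × (n ∸ j) ∉ ts))))
      × (suc (deg n ts j) ≡ deg n ts (suc j) ⇔ (j ∈ ts × (n ∸ j) ∉ ts))
      × (deg n ts j ≡ suc (deg n ts (suc j)) ⇔ ((n ∸ j) ∈ ts × j ∉ ts)))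
lemma22 zero    ts _ = (λ _ _ ()) , λ { (suc _) _ () }
lemma22 (suc m) ts _ =
  (λ { j 1≤j (s≤s j≤m) → proj₁ (degree-relations ts m j 1≤j j≤m) }) ,
  λ j 1≤j j≤m → let (_ , equal , up , down) = degree-relations ts m j 1≤j j≤m in
    ⇔.trans equal (mk⇔ (map₂ (in-range 1≤j j≤m)) (map₂ drop-range)) , up , down
  where
  in-range : ∀ {j} → 1 ≤ j → j ≤ m → ∀ {A B : Set} →
    A × B → (1 ≤ j × j ≤ m × A) × (1 ≤ suc m ∸ j × suc m ∸ j ≤ m × B)
  in-range {suc i} 1≤j j≤m (a , b) = (1≤j , j≤m , a) , (m<n⇒0<n∸m (s≤s j≤m) , m∸n≤m m i , b)

  drop-range : ∀ {A B C C′ D D′ : Set} → (C × C′ × A) × (D × D′ × B) → A × B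
  drop-range ((_ , _ , a) , (_ , _ , b)) = a , b
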